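{- Let $r$ be a nonnegative integer and $\lambda\in\mathbb{R}$. For integers $n\ge k\ge0$, $${n+r+1 \brack k+r}_{r,\lambda}={n+r \brack k+r-1}_{r,\lambda}+(r+n-k\lambda){n+r \brack k+r}_{r,\lambda},$$ and $${n+r+1 \brace k+r}_{r,\lambda}={n+r \brace k+r-1}_{r,\lambda}+(r+k-n\lambda){n+r \brace k+r}_{r,\lambda}.$$
   Context: $(x)_{0,\lambda}=1$, $(x)_{n,\lambda}=x(x-\lambda)\cdots(x-(n-1)\lambda)$; $\langle x\rangle_{0,\lambda}=1$, $\langle x\rangle_{n,\lambda}=x(x+\lambda)\cdots(x+(n-1)\lambda)$; $(x)_n=(x)_{n,1}$, $\langle x\rangle_n=\langle x\rangle_{n,1}$. For $n\ge0$ and $0\le k\le n$, the unsigned degenerate $r$-Stirling numbers of the first kind are defined by $\langle x+r\rangle_n=\sum_{k=0}^n{n+r \brack k+r}_{r,\lambda}\langle x\rangle_{k,\lambda}$, and the degenerate $r$-Stirling numbers of the second kind by $(x+r)_{n,\lambda}=\sum_{k=0}^n{n+r \brace k+r}_{r,\lambda}(x)_k$ (polynomial identities in $x$); by convention ${n+r \brack k+r}_{r,\lambda}={n+r \brace k+r}_{r,\lambda}=0$ when $k<0$ or $k>n$. -}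

module Defs where

open import Level using (_⊔_)
open import Data.Nat using (ℕ; zero; suc)
open import Data.Product using (_×_)
open import Data.Sum using (_⊎_)
open import Relation.Nullary using (¬_)
open import Algebra.Bundles using (CommutativeRing)

module _ {c ℓ} (R : CommutativeRing c ℓ) where
  open CommutativeRing R

  _⊖_ : Carrier → Carrier → Carrier
  x ⊖ y = x + (- y)

  ι : ℕ → Carrier
  ι zero = 0#
  ι (suc n) = 1# + ι n

  fallD : Carrier → Carrier → ℕ → Carrier
  fallD lam x zero = 1#
  fallD lam x (suc n) = fallD lam x n * (x ⊖ (ι n * lam))

  riseD : Carrier → Carrier → ℕ → Carrier
  riseD lam x zero = 1#
  riseD lam x (suc n) = riseD lam x n * (x + (ι n * lam))

  Σ≤ : ℕ → (ℕ → Carrier) → Carrier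
  Σ≤ zero f = f 0
  Σ≤ (suc n) f = Σ≤ n f + f (suc n)

  -- integral domain of characteristic zero (ℝ is one)
  Char0Domain : Set (c ⊔ ℓ)
  Char0Domain = (∀ x y → x * y ≈ 0# → (x ≈ 0#) ⊎ (y ≈ 0#))
              × (∀ n → ¬ (ι (suc n) ≈ 0#))

  -- S n k stands for [n+r, k+r]_{r,λ} (0 ≤ k ≤ n), defined by the
  -- polynomial identity ⟨x+r⟩_n = Σ_{k=0}^n [n+r,k+r]_{r,λ} ⟨x⟩_{k,λ}
  IsDegRStirling1 : ℕ → Carrier → (ℕ → ℕ → Carrier) → Set (c ⊔ ℓ)
  IsDegRStirling1 r lam S =
    ∀ n x → riseD 1# (x + ι r) n ≈ Σ≤ n (λ k → S n k * riseD lam x k)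

  -- T n k stands for {n+r, k+r}_{r,λ} (0 ≤ k ≤ n), defined by the
  -- polynomial identity (x+r)_{n,λ} = Σ_{k=0}^n {n+r,k+r}_{r,λ} (x)_k
  IsDegRStirling2 : ℕ → Carrier → (ℕ → ℕ → Carrier) → Set (c ⊔ ℓ)
  IsDegRStirling2 r lam T =
    ∀ n x → fallD lam (x + ι r) n ≈ Σ≤ n (λ k → T n k * fallD 1# x k)

  prevK : (ℕ → ℕ → Carrier) → ℕ → ℕ → Carrier
  prevK S n zero = 0#
  prevK S n (suc k) = S n k

-- Both identities describe how coefficients in a Newton basis
-- Nₖ(x) = (x + c₀)(x + c₁)⋯(x + cₖ₋₁) change under multiplication by a linear
-- factor: since x + d = (x + cₖ) + (d − cₖ), the term aₖNₖ becomes
-- aₖNₖ₊₁ + (d − cₖ)aₖNₖ.  For the first kind cⱼ = jλ, Nₖ = ⟨x⟩ₖ,λ and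
-- ⟨x+r⟩ₙ₊₁ = ⟨x+r⟩ₙ (x + r + n); for the second kind cⱼ = −j, Nₖ = (x)ₖ and
-- (x+r)ₙ₊₁,λ = (x+r)ₙ,λ (x + r − nλ).  Comparing coefficients is legitimate
-- because the defining identities hold for every x in a domain of
-- characteristic zero, where a polynomial function vanishing at 0, 1, 2, …
-- vanishes identically, so Newton coefficients are determined by the function.

module Submission where

open import Defs

open import Level using (_⊔_)
open import Data.Product using (∃; _×_; _,_; proj₁; proj₂)
open import Data.Sum using (_⊎_; inj₁; inj₂)
open import Algebra.Bundles using (CommutativeRing)
open import Algebra.Solver.Ring.AlmostCommutativeRing
  using (fromCommutativeRing; _-Raw-AlmostCommutative⟶_)
open import Data.Integer as ℤ using (ℤ; +_; -[1+_]; sign; ∣_∣)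
import Data.Integer.Properties as ℤₚ
open import Data.Maybe using (Maybe; just; nothing)
open import Data.Nat as ℕ using (ℕ; zero; suc; _≤_; _<_; z≤n; s≤s)
import Data.Nat.Properties as ℕₚ
open import Data.Sign as Sign using (Sign)
open import Relation.Binary.PropositionalEquality as ≡ using (_≡_; _≢_)
open import Function using (_∘_)
open import Relation.Nullary using (¬_; yes; no; contradiction)

-- The ring solver needs coefficients with decidable equality; ℤ acts on every
-- commutative ring.
module ℤ-Solver {c ℓ} (R : CommutativeRing c ℓ) where
  open CommutativeRing R
  open import Algebra.Properties.Ring ring using (-‿distribˡ-*; -‿involutive; -0#≈0#; -‿+-comm)
  open import Algebra.Properties.Semiring.Mult.TCOptimised semiring
    using (1+×; ×-homo-+; ×1-homo-*) renaming (_×_ to _×′_)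
  open import Algebra.Properties.CommutativeSemigroup *-commutativeSemigroup
    using (interchange)
  open import Relation.Binary.Reasoning.Setoid setoid

  ⟦_⟧ˢ : Sign → Carrier
  ⟦ Sign.+ ⟧ˢ = 1#
  ⟦ Sign.- ⟧ˢ = - 1#

  ⟦_⟧ᶻ : ℤ → Carrier
  ⟦ + n ⟧ᶻ      = n ×′ 1#
  ⟦ -[1+ n ] ⟧ᶻ = - (suc n ×′ 1#)

  ⟦⟧ˢ-homo-* : ∀ s t → ⟦ s Sign.* t ⟧ˢ ≈ ⟦ s ⟧ˢ * ⟦ t ⟧ˢ
  ⟦⟧ˢ-homo-* Sign.+ t      = sym (*-identityˡ _)
  ⟦⟧ˢ-homo-* Sign.- Sign.+ = sym (*-identityʳ _)
  ⟦⟧ˢ-homo-* Sign.- Sign.- = begin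
    1#              ≈⟨ -‿involutive 1# ⟨
    - - 1#          ≈⟨ -‿cong (*-identityˡ (- 1#)) ⟨
    - (1# * - 1#)   ≈⟨ -‿distribˡ-* 1# (- 1#) ⟩
    - 1# * - 1#     ∎

  ⟦⟧ᶻ-◃ : ∀ s n → ⟦ s ℤ.◃ n ⟧ᶻ ≈ ⟦ s ⟧ˢ * (n ×′ 1#)
  ⟦⟧ᶻ-◃ s      zero    = sym (zeroʳ _)
  ⟦⟧ᶻ-◃ Sign.+ (suc n) = sym (*-identityˡ _)
  ⟦⟧ᶻ-◃ Sign.- (suc n) = trans (-‿cong (sym (*-identityˡ _))) (-‿distribˡ-* _ _)

  ⟦⟧ᶻ-signAbs : ∀ i → ⟦ i ⟧ᶻ ≈ ⟦ sign i ⟧ˢ * (∣ i ∣ ×′ 1#)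
  ⟦⟧ᶻ-signAbs (+ n)    = sym (*-identityˡ _)
  ⟦⟧ᶻ-signAbs -[1+ n ] = ⟦⟧ᶻ-◃ Sign.- (suc n)

  ⟦⟧ᶻ-homo-* : ∀ i j → ⟦ i ℤ.* j ⟧ᶻ ≈ ⟦ i ⟧ᶻ * ⟦ j ⟧ᶻ
  ⟦⟧ᶻ-homo-* i j = begin
    ⟦ (sign i Sign.* sign j) ℤ.◃ (∣ i ∣ ℕ.* ∣ j ∣) ⟧ᶻ
      ≈⟨ ⟦⟧ᶻ-◃ (sign i Sign.* sign j) (∣ i ∣ ℕ.* ∣ j ∣) ⟩
    ⟦ sign i Sign.* sign j ⟧ˢ * ((∣ i ∣ ℕ.* ∣ j ∣) ×′ 1#)
      ≈⟨ *-cong (⟦⟧ˢ-homo-* (sign i) (sign j)) (×1-homo-* ∣ i ∣ ∣ j ∣) ⟩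
    (⟦ sign i ⟧ˢ * ⟦ sign j ⟧ˢ) * ((∣ i ∣ ×′ 1#) * (∣ j ∣ ×′ 1#))
      ≈⟨ interchange _ _ _ _ ⟩
    (⟦ sign i ⟧ˢ * (∣ i ∣ ×′ 1#)) * (⟦ sign j ⟧ˢ * (∣ j ∣ ×′ 1#))
      ≈⟨ *-cong (⟦⟧ᶻ-signAbs i) (⟦⟧ᶻ-signAbs j) ⟨
    ⟦ i ⟧ᶻ * ⟦ j ⟧ᶻ ∎

  ⟦⟧ᶻ-⊖ : ∀ m n → ⟦ m ℤ.⊖ n ⟧ᶻ ≈ m ×′ 1# + - (n ×′ 1#)
  ⟦⟧ᶻ-⊖ m zero = begin
    ⟦ m ℤ.⊖ 0 ⟧ᶻ       ≡⟨ ≡.cong ⟦_⟧ᶻ (ℤₚ.⊖-≥ {m} ℕ.z≤n) ⟩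
    m ×′ 1#            ≈⟨ +-identityʳ _ ⟨
    m ×′ 1# + 0#       ≈⟨ +-cong refl -0#≈0# ⟨
    m ×′ 1# + - 0#     ∎
  ⟦⟧ᶻ-⊖ zero (suc n) = begin
    ⟦ 0 ℤ.⊖ suc n ⟧ᶻ   ≡⟨ ≡.cong ⟦_⟧ᶻ (ℤₚ.⊖-≤ {0} {suc n} ℕ.z≤n) ⟩
    - (suc n ×′ 1#)     ≈⟨ +-identityˡ _ ⟨
    0# + - (suc n ×′ 1#) ∎
  ⟦⟧ᶻ-⊖ (suc m) (suc n) = begin
    ⟦ suc m ℤ.⊖ suc n ⟧ᶻ        ≡⟨ ≡.cong ⟦_⟧ᶻ (ℤₚ.[1+m]⊖[1+n]≡m⊖n m n) ⟩
    ⟦ m ℤ.⊖ n ⟧ᶻ                ≈⟨ ⟦⟧ᶻ-⊖ m n ⟩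
    M + - N                     ≈⟨ +-identityˡ _ ⟨
    0# + (M + - N)              ≈⟨ +-cong (-‿inverseʳ 1#) refl ⟨
    (1# + - 1#) + (M + - N)     ≈⟨ +-interchange 1# (- 1#) M (- N) ⟩
    (1# + M) + (- 1# + - N)     ≈⟨ +-cong (sym (1+× m 1#)) (-‿+-comm 1# N) ⟩
    suc m ×′ 1# + - (1# + N)    ≈⟨ +-cong refl (-‿cong (1+× n 1#)) ⟨
    suc m ×′ 1# + - (suc n ×′ 1#) ∎
    where
    open import Algebra.Properties.CommutativeSemigroup +-commutativeSemigroup
      using () renaming (interchange to +-interchange)
    M = m ×′ 1#
    N = n ×′ 1#

  ⟦⟧ᶻ-homo-+ : ∀ i j → ⟦ i ℤ.+ j ⟧ᶻ ≈ ⟦ i ⟧ᶻ + ⟦ j ⟧ᶻ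
  ⟦⟧ᶻ-homo-+ (+ m)    (+ n)    = ×-homo-+ 1# m n
  ⟦⟧ᶻ-homo-+ (+ m)    -[1+ n ] = ⟦⟧ᶻ-⊖ m (suc n)
  ⟦⟧ᶻ-homo-+ -[1+ m ] (+ n)    = trans (⟦⟧ᶻ-⊖ n (suc m)) (+-comm _ _)
  ⟦⟧ᶻ-homo-+ -[1+ m ] -[1+ n ] = begin
    - (suc (suc (m ℕ.+ n)) ×′ 1#)          ≡⟨ ≡.cong (λ k → - (suc k ×′ 1#)) (ℕₚ.+-suc m n) ⟨
    - ((suc m ℕ.+ suc n) ×′ 1#)            ≈⟨ -‿cong (×-homo-+ 1# (suc m) (suc n)) ⟩
    - (suc m ×′ 1# + suc n ×′ 1#)          ≈⟨ -‿+-comm _ _ ⟨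
    - (suc m ×′ 1#) + - (suc n ×′ 1#)      ∎

  ⟦⟧ᶻ-homo-- : ∀ i → ⟦ ℤ.- i ⟧ᶻ ≈ - ⟦ i ⟧ᶻ
  ⟦⟧ᶻ-homo-- (+ zero)  = sym -0#≈0#
  ⟦⟧ᶻ-homo-- (+ suc n) = refl
  ⟦⟧ᶻ-homo-- -[1+ n ]  = sym (-‿involutive _)

  ⟦⟧ᶻ-morphism : ℤ.+-*-rawRing -Raw-AlmostCommutative⟶ fromCommutativeRing R
  ⟦⟧ᶻ-morphism = record
    { ⟦_⟧    = ⟦_⟧ᶻ
    ; +-homo = ⟦⟧ᶻ-homo-+
    ; *-homo = ⟦⟧ᶻ-homo-*
    ; -‿homo = ⟦⟧ᶻ-homo--
    ; 0-homo = refl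
    ; 1-homo = refl
    }

  ⟦⟧ᶻ-≟ : ∀ i j → Maybe (⟦ i ⟧ᶻ ≈ ⟦ j ⟧ᶻ)
  ⟦⟧ᶻ-≟ i j with i ℤ.≟ j
  ... | yes ≡.refl = just refl
  ... | no  _      = nothing

  open import Algebra.Solver.Ring ℤ.+-*-rawRing (fromCommutativeRing R) ⟦⟧ᶻ-morphism ⟦⟧ᶻ-≟ public
    using (solve; _:=_; _:+_; _:*_; :-_; _:-_; con)

_[_]≔_ : ∀ {a} {A : Set a} → (ℕ → A) → ℕ → A → ℕ → A
(f [ i ]≔ v) k with k ℕ.≟ i
... | yes _ = v
... | no  _ = f k

[]≔-updated : ∀ {a} {A : Set a} (f : ℕ → A) i v → (f [ i ]≔ v) i ≡ v
[]≔-updated f i v with i ℕ.≟ i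
... | yes _   = ≡.refl
... | no  i≢i = contradiction ≡.refl i≢i

[]≔-unchanged : ∀ {a} {A : Set a} (f : ℕ → A) {i k} v → k ≢ i → (f [ i ]≔ v) k ≡ f k
[]≔-unchanged f {i} {k} v k≢i with k ℕ.≟ i
... | yes k≡i = contradiction k≡i k≢i
... | no  _   = ≡.refl

module FiniteSums {c ℓ} (R : CommutativeRing c ℓ) where
  open CommutativeRing R
  open ℤ-Solver R

  Σ≤-cong : ∀ n {f g} → (∀ k → k ≤ n → f k ≈ g k) → Σ≤ R n f ≈ Σ≤ R n g
  Σ≤-cong zero    f≈g = f≈g 0 z≤n
  Σ≤-cong (suc n) f≈g = +-cong (Σ≤-cong n (λ k k≤n → f≈g k (ℕₚ.m≤n⇒m≤1+n k≤n))) (f≈g (suc n) ℕₚ.≤-refl)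

  Σ≤-- : ∀ n f g → Σ≤ R n (λ k → f k + - g k) ≈ Σ≤ R n f + - Σ≤ R n g
  Σ≤-- zero    f g = refl
  Σ≤-- (suc n) f g = trans (+-cong (Σ≤-- n f g) refl) (regroup _ _ _ _)
    where
    regroup : ∀ F G a b → (F + - G) + (a + - b) ≈ (F + a) + - (G + b)
    regroup = solve 4 (λ F G a b → (F :- G) :+ (a :- b) := (F :+ a) :- (G :+ b)) refl

module Polynomials {c ℓ} (R : CommutativeRing c ℓ) where
  open CommutativeRing R
  open ℤ-Solver R
  open import Algebra.Properties.Group +-group using (x∙y⁻¹≈ε⇒x≈y)
  open import Relation.Binary.Reasoning.Setoid setoid

  data Deg≤ : ℕ → (Carrier → Carrier) → Set (c ⊔ ℓ) where
    constant : ∀ {f} a → (∀ x → f x ≈ a) → Deg≤ 0 f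
    horner   : ∀ {n f} a g → Deg≤ n g → (∀ x → f x ≈ a + x * g x) → Deg≤ (suc n) f

  deg≤-resp : ∀ {n f g} → (∀ x → f x ≈ g x) → Deg≤ n f → Deg≤ n g
  deg≤-resp f≈g (constant a f≈a)   = constant a (λ x → trans (sym (f≈g x)) (f≈a x))
  deg≤-resp f≈g (horner a h dh f≈) = horner a h dh (λ x → trans (sym (f≈g x)) (f≈ x))

  deg≤-suc : ∀ {n f} → Deg≤ n f → Deg≤ (suc n) f
  deg≤-suc (constant a f≈a) =
    horner a (λ _ → 0#) (constant 0# (λ _ → refl)) (λ x → trans (f≈a x) (a≈a+x*0 a x))
    where
    a≈a+x*0 : ∀ a x → a ≈ a + x * 0#
    a≈a+x*0 = solve 2 (λ a x → a := a :+ x :* con (+ 0)) refl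
  deg≤-suc (horner a g dg f≈) = horner a g (deg≤-suc dg) f≈

  deg≤-+ : ∀ {n f g} → Deg≤ n f → Deg≤ n g → Deg≤ n (λ x → f x + g x)
  deg≤-+ (constant a f≈) (constant b g≈) = constant (a + b) (λ x → +-cong (f≈ x) (g≈ x))
  deg≤-+ (horner a f′ df f≈) (horner b g′ dg g≈) =
    horner (a + b) (λ x → f′ x + g′ x) (deg≤-+ df dg)
      (λ x → trans (+-cong (f≈ x) (g≈ x)) (regroup a b x (f′ x) (g′ x)))
    where
    regroup : ∀ a b x u v → (a + x * u) + (b + x * v) ≈ (a + b) + x * (u + v)
    regroup = solve 5 (λ a b x u v →
      (a :+ x :* u) :+ (b :+ x :* v) := (a :+ b) :+ x :* (u :+ v)) refl

  deg≤-scale : ∀ {n f} s → Deg≤ n f → Deg≤ n (λ x → s * f x)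
  deg≤-scale s (constant a f≈) = constant (s * a) (λ x → *-cong refl (f≈ x))
  deg≤-scale s (horner a g dg f≈) =
    horner (s * a) (λ x → s * g x) (deg≤-scale s dg)
      (λ x → trans (*-cong refl (f≈ x)) (distribute s a x (g x)))
    where
    distribute : ∀ s a x u → s * (a + x * u) ≈ s * a + x * (s * u)
    distribute = solve 4 (λ s a x u → s :* (a :+ x :* u) := s :* a :+ x :* (s :* u)) refl

  deg≤-*linear : ∀ {n f} d → Deg≤ n f → Deg≤ (suc n) (λ x → f x * (x + d))
  deg≤-*linear {f = f} d df =
    deg≤-resp (λ x → expand (f x) x d)
      (deg≤-+ (horner 0# f df (λ x → sym (+-identityˡ _))) (deg≤-suc (deg≤-scale d df)))
    where
    expand : ∀ y x d → x * y + d * y ≈ y * (x + d)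
    expand = solve 3 (λ y x d → x :* y :+ d :* y := y :* (x :+ d)) refl

  factor-theorem : ∀ {n f} → Deg≤ (suc n) f → ∀ t →
    ∃ λ q → Deg≤ n q × (∀ x → f x ≈ f t + (x + - t) * q x)
  factor-theorem {f = f} (horner a g (constant b g≈b) f≈) t =
    (λ _ → b) , constant b (λ _ → refl) , λ x → begin
      f x                         ≈⟨ f≈ x ⟩
      a + x * g x                 ≈⟨ +-cong refl (*-cong refl (g≈b x)) ⟩
      a + x * b                   ≈⟨ shift a x t b ⟩
      (a + t * b) + (x + - t) * b ≈⟨ +-cong (trans (f≈ t) (+-cong refl (*-cong refl (g≈b t)))) refl ⟨
      f t + (x + - t) * b         ∎
    where
    shift : ∀ a x t b → a + x * b ≈ (a + t * b) + (x + - t) * b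
    shift = solve 4 (λ a x t b → a :+ x :* b := (a :+ t :* b) :+ (x :- t) :* b) refl
  factor-theorem {f = f} (horner a g dg@(horner _ _ _ _) f≈) t
    with q , dq , g≈ ← factor-theorem dg t =
    (λ x → g t + x * q x) , horner (g t) q dq (λ _ → refl) , λ x → begin
      f x                                    ≈⟨ f≈ x ⟩
      a + x * g x                            ≈⟨ +-cong refl (*-cong refl (g≈ x)) ⟩
      a + x * (g t + (x + - t) * q x)        ≈⟨ shift a x t (g t) (q x) ⟩
      (a + t * g t) + (x + - t) * (g t + x * q x) ≈⟨ +-cong (f≈ t) refl ⟨
      f t + (x + - t) * (g t + x * q x)      ∎
    where
    shift : ∀ a x t b c → a + x * (b + (x + - t) * c) ≈ (a + t * b) + (x + - t) * (b + x * c)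
    shift = solve 5 (λ a x t b c →
      a :+ x :* (b :+ (x :- t) :* c) := (a :+ t :* b) :+ (x :- t) :* (b :+ x :* c)) refl

  module IdentityTheorem
    (no-zero-divisors : ∀ x y → x * y ≈ 0# → x ≈ 0# ⊎ y ≈ 0#)
    (u : ℕ → Carrier) (u-injective : ∀ {m n} → m < n → ¬ u n ≈ u m)
    where

    -- The exceptional point is what (x − e) g x ≈ 0 provides: g (u m) ≈ 0 unless
    -- u m ≈ e, and which of the two holds cannot be decided.
    VanishesBeyondExcept : (Carrier → Carrier) → ℕ → Carrier → Set ℓ
    VanishesBeyondExcept f N e = ∀ m → N ≤ m → u m ≈ e ⊎ f (u m) ≈ 0#

    root-beyond : ∀ {f N e} → VanishesBeyondExcept f N e → ∃ λ M → N ≤ M × f (u M) ≈ 0#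
    root-beyond {N = N} vanishes with vanishes N ℕₚ.≤-refl | vanishes (suc N) (ℕₚ.n≤1+n N)
    ... | inj₂ fuN≈0 | _            = N , ℕₚ.≤-refl , fuN≈0
    ... | inj₁ _     | inj₂ fuN+1≈0 = suc N , ℕₚ.n≤1+n N , fuN+1≈0
    ... | inj₁ uN≈e  | inj₁ uN+1≈e  = contradiction (trans uN+1≈e (sym uN≈e)) (u-injective ℕₚ.≤-refl)

    identically-zero : ∀ {n f N e} → Deg≤ n f → VanishesBeyondExcept f N e → ∀ x → f x ≈ 0#
    identically-zero {f = f} (constant a f≈a) vanishes x
      with M , _ , fuM≈0 ← root-beyond {f} vanishes =
      trans (f≈a x) (trans (sym (f≈a (u M))) fuM≈0)
    identically-zero {f = f} {e = e} df@(horner _ _ _ _) vanishes x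
      with M , N≤M , fuM≈0 ← root-beyond {f} vanishes
      with q , dq , f≈ ← factor-theorem df (u M) = begin
        f x                             ≈⟨ f≈ x ⟩
        f (u M) + (x + - u M) * q x     ≈⟨ +-cong fuM≈0 (*-cong refl (identically-zero dq q-vanishes x)) ⟩
        0# + (x + - u M) * 0#           ≈⟨ collapse x (u M) ⟩
        0#                              ∎
      where
      collapse : ∀ x t → 0# + (x + - t) * 0# ≈ 0#
      collapse = solve 2 (λ x t → con (+ 0) :+ (x :- t) :* con (+ 0) := con (+ 0)) refl
      q-vanishes : VanishesBeyondExcept q (suc M) e
      q-vanishes m M<m with vanishes m (ℕₚ.≤-trans N≤M (ℕₚ.<⇒≤ M<m))
      ... | inj₁ um≈e = inj₁ um≈e
      ... | inj₂ fum≈0 with no-zero-divisors (u m + - u M) (q (u m)) (begin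
        (u m + - u M) * q (u m)            ≈⟨ +-identityˡ _ ⟨
        0# + (u m + - u M) * q (u m)       ≈⟨ +-cong fuM≈0 refl ⟨
        f (u M) + (u m + - u M) * q (u m)  ≈⟨ f≈ (u m) ⟨
        f (u m)                            ≈⟨ fum≈0 ⟩
        0#                                 ∎)
      ... | inj₁ um-uM≈0 = contradiction (x∙y⁻¹≈ε⇒x≈y _ _ um-uM≈0) (u-injective M<m)
      ... | inj₂ qum≈0   = inj₂ qum≈0

  newton : (ℕ → Carrier) → ℕ → Carrier → Carrier
  newton cs zero    x = 1#
  newton cs (suc k) x = newton cs k x * (x + cs k)

  newtonSum : (ℕ → Carrier) → (ℕ → Carrier) → ℕ → Carrier → Carrier
  newtonSum cs a n x = Σ≤ R n (λ k → a k * newton cs k x)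

  deg≤-newton : ∀ cs k → Deg≤ k (newton cs k)
  deg≤-newton cs zero    = constant 1# (λ _ → refl)
  deg≤-newton cs (suc k) = deg≤-*linear (cs k) (deg≤-newton cs k)

  deg≤-newtonSum : ∀ cs a n → Deg≤ n (newtonSum cs a n)
  deg≤-newtonSum cs a zero    = deg≤-scale (a 0) (deg≤-newton cs 0)
  deg≤-newtonSum cs a (suc n) =
    deg≤-+ (deg≤-suc (deg≤-newtonSum cs a n)) (deg≤-scale (a (suc n)) (deg≤-newton cs (suc n)))

  newton-suc : ∀ cs k x → newton cs (suc k) x ≈ (x + cs 0) * newton (cs ∘ suc) k x
  newton-suc cs zero    x = *-comm _ _
  newton-suc cs (suc k) x = trans (*-cong (newton-suc cs k x) refl) (*-assoc _ _ _)

  newtonSum-suc : ∀ cs a n x →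
    newtonSum cs a (suc n) x ≈ a 0 + (x + cs 0) * newtonSum (cs ∘ suc) (a ∘ suc) n x
  newtonSum-suc cs a zero x = regroup (a 0) (a 1) x (cs 0)
    where
    regroup : ∀ a₀ a₁ x c → a₀ * 1# + a₁ * (1# * (x + c)) ≈ a₀ + (x + c) * (a₁ * 1#)
    regroup = solve 4 (λ a₀ a₁ x c → a₀ :* con (+ 1) :+ a₁ :* (con (+ 1) :* (x :+ c))
                                   := a₀ :+ (x :+ c) :* (a₁ :* con (+ 1))) refl
  newtonSum-suc cs a (suc n) x =
    trans (+-cong (newtonSum-suc cs a n x) (*-cong refl (newton-suc cs (suc n) x)))
          (regroup (a 0) (x + cs 0) _ (a (2 ℕ.+ n)) _)
    where
    regroup : ∀ a₀ y T b M → (a₀ + y * T) + b * (y * M) ≈ a₀ + y * (T + b * M)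
    regroup = solve 5 (λ a₀ y T b M → (a₀ :+ y :* T) :+ b :* (y :* M) := a₀ :+ y :* (T :+ b :* M)) refl

  prev : (ℕ → Carrier) → ℕ → Carrier
  prev s zero    = 0#
  prev s (suc k) = s k

  prevK≡prev : ∀ (S : ℕ → ℕ → Carrier) n k → prevK R S n k ≡ prev (S n) k
  prevK≡prev S n zero    = ≡.refl
  prevK≡prev S n (suc k) = ≡.refl

  newtonSum-*linear : ∀ cs d s n x →
    newtonSum cs s n x * (x + d) ≈
    newtonSum cs (λ k → prev s k + (d + - cs k) * s k) n x + s n * newton cs (suc n) x
  newtonSum-*linear cs d s zero x = base (s 0) x d (cs 0)
    where
    base : ∀ s x d c → s * 1# * (x + d) ≈ (0# + (d + - c) * s) * 1# + s * (1# * (x + c))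
    base = solve 4 (λ s x d c → s :* con (+ 1) :* (x :+ d)
      := (con (+ 0) :+ (d :- c) :* s) :* con (+ 1) :+ s :* (con (+ 1) :* (x :+ c))) refl
  newtonSum-*linear cs d s (suc n) x = begin
    (sum + s (suc n) * N) * (x + d)              ≈⟨ distribʳ _ _ _ ⟩
    sum * (x + d) + s (suc n) * N * (x + d)      ≈⟨ +-cong (newtonSum-*linear cs d s n x) refl ⟩
    (sum′ + s n * N) + s (suc n) * N * (x + d)   ≈⟨ regroup sum′ (s n) (s (suc n)) N x d (cs (suc n)) ⟩
    (sum′ + (s n + (d + - cs (suc n)) * s (suc n)) * N) + s (suc n) * (N * (x + cs (suc n))) ∎
    where
    sum sum′ N : Carrier
    sum  = newtonSum cs s n x
    sum′ = newtonSum cs (λ k → prev s k + (d + - cs k) * s k) n x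
    N    = newton cs (suc n) x
    regroup : ∀ T a b N x d c →
      (T + a * N) + b * N * (x + d) ≈ (T + (a + (d + - c) * b) * N) + b * (N * (x + c))
    regroup = solve 7 (λ T a b N x d c → (T :+ a :* N) :+ b :* N :* (x :+ d)
      := (T :+ (a :+ (d :- c) :* b) :* N) :+ b :* (N :* (x :+ c))) refl

module NewtonCoefficients {c ℓ} (R : CommutativeRing c ℓ) (char0 : Char0Domain R) where
  open CommutativeRing R
  open ℤ-Solver R
  open FiniteSums R
  open Polynomials R
  open import Algebra.Properties.Group +-group using (inverseˡ-unique; x∙y⁻¹≈ε⇒x≈y; x≈y⇒x∙y⁻¹≈ε)
  open import Relation.Binary.Reasoning.Setoid setoid

  ι-+ : ∀ m n → ι R (m ℕ.+ n) ≈ ι R m + ι R n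
  ι-+ zero    n = sym (+-identityˡ _)
  ι-+ (suc m) n = trans (+-cong refl (ι-+ m n)) (sym (+-assoc _ _ _))

  ι-injective : ∀ {m n} → m < n → ¬ ι R n ≈ ι R m
  ι-injective {m} m<n ιn≈ιm with o , ≡.refl ← ℕₚ.m≤n⇒∃[o]m+o≡n m<n =
    proj₂ char0 o (begin
      1# + ι R o                          ≈⟨ cancel (ι R m) (ι R o) ⟩
      (1# + (ι R m + ι R o)) + - ι R m    ≈⟨ +-cong (+-cong refl (ι-+ m o)) refl ⟨
      ι R (suc m ℕ.+ o) + - ι R m         ≈⟨ +-cong ιn≈ιm refl ⟩
      ι R m + - ι R m                     ≈⟨ -‿inverseʳ _ ⟩
      0#                                  ∎)
    where
    cancel : ∀ x y → 1# + y ≈ (1# + (x + y)) + - x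
    cancel = solve 2 (λ x y → con (+ 1) :+ y := (con (+ 1) :+ (x :+ y)) :- x) refl

  open IdentityTheorem (proj₁ char0) (ι R) ι-injective

  newtonSum≈0⇒coeff≈0 : ∀ n cs a → (∀ x → newtonSum cs a n x ≈ 0#) → ∀ k → k ≤ n → a k ≈ 0#
  newtonSum≈0⇒coeff≈0 zero cs a sum≈0 zero _ = trans (sym (*-identityʳ _)) (sum≈0 0#)
  newtonSum≈0⇒coeff≈0 (suc n) cs a sum≈0 = coeff≈0
    where
    tail : Carrier → Carrier
    tail = newtonSum (cs ∘ suc) (a ∘ suc) n

    a₀≈0 : a 0 ≈ 0#
    a₀≈0 = begin
      a 0                                     ≈⟨ kill (a 0) (cs 0) (tail (- cs 0)) ⟨
      a 0 + (- cs 0 + cs 0) * tail (- cs 0)   ≈⟨ newtonSum-suc cs a n (- cs 0) ⟨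
      newtonSum cs a (suc n) (- cs 0)         ≈⟨ sum≈0 (- cs 0) ⟩
      0#                                      ∎
      where
      kill : ∀ a c t → a + (- c + c) * t ≈ a
      kill = solve 3 (λ a c t → a :+ (:- c :+ c) :* t := a) refl

    linear*tail≈0 : ∀ x → (x + cs 0) * tail x ≈ 0#
    linear*tail≈0 x = begin
      (x + cs 0) * tail x          ≈⟨ +-identityˡ _ ⟨
      0# + (x + cs 0) * tail x     ≈⟨ +-cong a₀≈0 refl ⟨
      a 0 + (x + cs 0) * tail x    ≈⟨ newtonSum-suc cs a n x ⟨
      newtonSum cs a (suc n) x     ≈⟨ sum≈0 x ⟩
      0#                           ∎

    tail-vanishes : VanishesBeyondExcept tail 0 (- cs 0)
    tail-vanishes m _ with proj₁ char0 _ _ (linear*tail≈0 (ι R m))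
    ... | inj₁ ιm+c₀≈0 = inj₁ (inverseˡ-unique _ _ ιm+c₀≈0)
    ... | inj₂ tail≈0  = inj₂ tail≈0

    coeff≈0 : ∀ k → k ≤ suc n → a k ≈ 0#
    coeff≈0 zero    _         = a₀≈0
    coeff≈0 (suc k) (s≤s k≤n) =
      newtonSum≈0⇒coeff≈0 n (cs ∘ suc) (a ∘ suc)
        (identically-zero (deg≤-newtonSum (cs ∘ suc) (a ∘ suc) n) tail-vanishes) k k≤n

  newtonSum-injective : ∀ n cs a b → (∀ x → newtonSum cs a n x ≈ newtonSum cs b n x) →
    ∀ k → k ≤ n → a k ≈ b k
  newtonSum-injective n cs a b sums≈ k k≤n =
    x∙y⁻¹≈ε⇒x≈y _ _ (newtonSum≈0⇒coeff≈0 n cs (λ k → a k + - b k) difference≈0 k k≤n)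
    where
    difference≈0 : ∀ x → newtonSum cs (λ k → a k + - b k) n x ≈ 0#
    difference≈0 x = begin
      Σ≤ R n (λ k → (a k + - b k) * newton cs k x)
        ≈⟨ Σ≤-cong n (λ k _ → distrib-- (a k) (b k) (newton cs k x)) ⟩
      Σ≤ R n (λ k → a k * newton cs k x + - (b k * newton cs k x))
        ≈⟨ Σ≤-- n _ _ ⟩
      newtonSum cs a n x + - newtonSum cs b n x
        ≈⟨ x≈y⇒x∙y⁻¹≈ε (sums≈ x) ⟩
      0# ∎
      where
      distrib-- : ∀ a b N → (a + - b) * N ≈ a * N + - (b * N)
      distrib-- = solve 3 (λ a b N → (a :- b) :* N := a :* N :- b :* N) refl

  newton-recurrence : ∀ cs (d : ℕ → Carrier) (P : ℕ → Carrier → Carrier) (S : ℕ → ℕ → Carrier) →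
    (∀ n x → P (suc n) x ≈ P n x * (x + d n)) →
    (∀ n x → P n x ≈ newtonSum cs (S n) n x) →
    ∀ n k → k ≤ n → S (suc n) k ≈ prevK R S n k + (d n + - cs k) * S n k
  newton-recurrence cs d P S P-suc P≈ n k k≤n = begin
    S (suc n) k       ≈⟨ newtonSum-injective (suc n) cs (S (suc n)) B expansions≈ k (ℕₚ.m≤n⇒m≤1+n k≤n) ⟩
    B k               ≡⟨ B≡C k≤n ⟩
    C k               ≡⟨ ≡.cong (λ p → p + (d n + - cs k) * S n k) (prevK≡prev S n k) ⟨
    prevK R S n k + (d n + - cs k) * S n k ∎
    where
    C B : ℕ → Carrier
    C k = prev (S n) k + (d n + - cs k) * S n k
    B   = C [ suc n ]≔ S n n

    B≡C : ∀ {k} → k ≤ n → B k ≡ C k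
    B≡C k≤n = []≔-unchanged C (S n n) (ℕₚ.<⇒≢ (s≤s k≤n))

    expansions≈ : ∀ x → newtonSum cs (S (suc n)) (suc n) x ≈ newtonSum cs B (suc n) x
    expansions≈ x = begin
      newtonSum cs (S (suc n)) (suc n) x                 ≈⟨ P≈ (suc n) x ⟨
      P (suc n) x                                        ≈⟨ P-suc n x ⟩
      P n x * (x + d n)                                  ≈⟨ *-cong (P≈ n x) refl ⟩
      newtonSum cs (S n) n x * (x + d n)                 ≈⟨ newtonSum-*linear cs (d n) (S n) n x ⟩
      newtonSum cs C n x + S n n * newton cs (suc n) x
        ≈⟨ +-cong (Σ≤-cong n (λ k k≤n → *-cong (reflexive (≡.sym (B≡C k≤n))) refl))
                  (*-cong (reflexive (≡.sym ([]≔-updated C (suc n) (S n n)))) refl) ⟩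
      newtonSum cs B (suc n) x                           ∎

module DegenerateStirling {c ℓ} (R : CommutativeRing c ℓ) (char0 : Char0Domain R) where
  open CommutativeRing R
  open ℤ-Solver R
  open FiniteSums R
  open Polynomials R
  open NewtonCoefficients R char0

  riseD≡newton : ∀ lam x k → riseD R lam x k ≡ newton (λ j → ι R j * lam) k x
  riseD≡newton lam x zero    = ≡.refl
  riseD≡newton lam x (suc k) = ≡.cong (_* (x + ι R k * lam)) (riseD≡newton lam x k)

  fallD≡newton : ∀ lam x k → fallD R lam x k ≡ newton (λ j → - (ι R j * lam)) k x
  fallD≡newton lam x zero    = ≡.refl
  fallD≡newton lam x (suc k) = ≡.cong (_* (x + - (ι R k * lam))) (fallD≡newton lam x k)

  rStirling1-recurrence : ∀ r lam S → IsDegRStirling1 R r lam S → ∀ n k → k ≤ n →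
    S (suc n) k ≈ prevK R S n k + ((ι R r + ι R n) + - (ι R k * lam)) * S n k
  rStirling1-recurrence r lam S isS n k k≤n =
    trans (newton-recurrence (λ j → ι R j * lam) (λ n → ι R r + ι R n * 1#)
             (λ n x → riseD R 1# (x + ι R r) n) S
             (λ n x → *-cong refl (+-assoc _ _ _))
             (λ n x → trans (isS n x) (Σ≤-cong n (λ k _ → *-cong refl (reflexive (riseD≡newton lam x k)))))
             n k k≤n)
          (+-cong refl (*-cong (+-cong (+-cong refl (*-identityʳ _)) refl) refl))

  rStirling2-recurrence : ∀ r lam T → IsDegRStirling2 R r lam T → ∀ n k → k ≤ n →
    T (suc n) k ≈ prevK R T n k + ((ι R r + ι R k) + - (ι R n * lam)) * T n k
  rStirling2-recurrence r lam T isT n k k≤n =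
    trans (newton-recurrence (λ j → - (ι R j * 1#)) (λ n → ι R r + - (ι R n * lam))
             (λ n x → fallD R lam (x + ι R r) n) T
             (λ n x → *-cong refl (+-assoc _ _ _))
             (λ n x → trans (isT n x) (Σ≤-cong n (λ k _ → *-cong refl (reflexive (fallD≡newton 1# x k)))))
             n k k≤n)
          (+-cong refl (*-cong (regroup (ι R r) (ι R n * lam) (ι R k)) refl))
    where
    regroup : ∀ a b k → (a + - b) + - - (k * 1#) ≈ (a + k) + - b
    regroup = solve 3 (λ a b k → (a :- b) :+ :- :- (k :* con (+ 1)) := (a :+ k) :- b) refl

theorem8 : ∀ {c ℓ} (R : CommutativeRing c ℓ) → Char0Domain R →
    let open CommutativeRing R in
    (r : ℕ) (lam : Carrier) (S T : ℕ → ℕ → Carrier) →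
    IsDegRStirling1 R r lam S → IsDegRStirling2 R r lam T →
    (n k : ℕ) → k ≤ n →
      (S (suc n) k ≈ prevK R S n k + ((ι R r + ι R n) + (- (ι R k * lam))) * S n k)
    × (T (suc n) k ≈ prevK R T n k + ((ι R r + ι R k) + (- (ι R n * lam))) * T n k)
theorem8 R char0 r lam S T isS isT n k k≤n =
    rStirling1-recurrence r lam S isS n k k≤n
  , rStirling2-recurrence r lam T isT n k k≤n
  where open DegenerateStirling R char0
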